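{- Let $\delta\geq 2$ be an integer and let $G$ be a connected graph of even order $n\geq\max\{6\delta-4,\frac{1}{6}(\delta^{2}+7\delta+4)\}$ with minimum degree $\delta(G)=\delta$. If $$e(G)\geq e\big(K_{\delta}\vee(K_{n-2\delta+1}\cup(\delta-1)K_1)\big),$$ then $G$ contains an even factor, unless $G=K_{\delta}\vee(K_{n-2\delta+1}\cup(\delta-1)K_1)$.
   Context: All graphs are finite, undirected, without loops or multiple edges. $e(G)$ denotes the number of edges of $G$. $K_m$ is the complete graph on $m$ vertices; $(\delta-1)K_1$ is the graph consisting of $\delta-1$ isolated vertices. $G_1\cup G_2$ is the disjoint union of vertex-disjoint graphs, and the join $G_1\vee G_2$ is obtained from $G_1\cup G_2$ by adding all edges between $V(G_1)$ and $V(G_2)$. An even factor of $G$ is a spanning subgraph $F$ of $G$ such that $d_F(v)\in\{2,4,6,\ldots\}$ for every vertex $v\in V(G)$. -}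

module Defs where

open import Data.Nat using (ℕ; zero; suc; _+_; _∸_; _<ᵇ_; _≤_; _<_)
open import Data.Nat.Divisibility using (_∣_)
open import Data.Fin using (Fin; toℕ; _≟_)
open import Data.Bool using (Bool; true; false; not; _∧_; if_then_else_)
open import Data.Product using (Σ; ∃; _×_; _,_)
open import Relation.Nullary using (does; yes; no)
open import Relation.Binary.PropositionalEquality using (_≡_; refl; sym)
open import Function.Bundles using (_↔_; Inverse)

record Graph (n : ℕ) : Set where
  field
    adj    : Fin n → Fin n → Bool
    adj-sym : ∀ i j → adj i j ≡ adj j i
    adj-irr : ∀ i → adj i i ≡ false
open Graph public

countTrue : ∀ {n} → (Fin n → Bool) → ℕ
countTrue {zero}  f = 0
countTrue {suc n} f = (if f Data.Fin.zero then 1 else 0) + countTrue (λ i → f (Data.Fin.suc i))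

deg : ∀ {n} → Graph n → Fin n → ℕ
deg G v = countTrue (adj G v)

sumFin : ∀ {n} → (Fin n → ℕ) → ℕ
sumFin {zero}  f = 0
sumFin {suc n} f = f Data.Fin.zero + sumFin (λ i → f (Data.Fin.suc i))

e : ∀ {n} → Graph n → ℕ
e G = sumFin (λ i → countTrue (λ j → (toℕ i <ᵇ toℕ j) ∧ adj G i j))

MinDegree : ∀ {n} → Graph n → ℕ → Set
MinDegree G d = (∀ v → d ≤ deg G v) × (∃ λ v → deg G v ≡ d)

data Reach {n} (G : Graph n) : Fin n → Fin n → Set where
  here : ∀ {u} → Reach G u u
  step : ∀ {u w v} → adj G u w ≡ true → Reach G w v → Reach G u v

Connected : ∀ {n} → Graph n → Set
Connected G = ∀ u v → Reach G u v

Subgraph : ∀ {n} → Graph n → Graph n → Set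
Subgraph F G = ∀ i j → adj F i j ≡ true → adj G i j ≡ true

HasEvenFactor : ∀ {n} → Graph n → Set
HasEvenFactor {n} G = Σ (Graph n) λ F → Subgraph F G × (∀ v → 2 ≤ deg F v × 2 ∣ deg F v)

_≅_ : ∀ {n} → Graph n → Graph n → Set
_≅_ {n} G H = Σ (Fin n ↔ Fin n) λ σ →
  ∀ i j → adj G i j ≡ adj H (Inverse.to σ i) (Inverse.to σ j)

-- The graph K_d ∨ (K_{n-2d+1} ∪ (d-1)K_1) on Fin n:
-- vertices 0..d-1 form K_d (class A), vertices d..n-d form K_{n-2d+1} (class B),
-- vertices n-d+1..n-1 are the d-1 isolated vertices (class C) before the join.
data Cls : Set where
  A B C : Cls

rel : Cls → Cls → Bool
rel A _ = true
rel B A = true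
rel B B = true
rel B C = false
rel C A = true
rel C B = false
rel C C = false

rel-sym : ∀ x y → rel x y ≡ rel y x
rel-sym A A = refl
rel-sym A B = refl
rel-sym A C = refl
rel-sym B A = refl
rel-sym B B = refl
rel-sym B C = refl
rel-sym C A = refl
rel-sym C B = refl
rel-sym C C = refl

cls : ℕ → ℕ → ℕ → Cls
cls n d i = if i <ᵇ d then A else (if i <ᵇ (n ∸ d) + 1 then B else C)

extAdj : (n d : ℕ) → Fin n → Fin n → Bool
extAdj n d i j = not (does (i ≟ j)) ∧ rel (cls n d (toℕ i)) (cls n d (toℕ j))

extAdj-sym : ∀ n d i j → extAdj n d i j ≡ extAdj n d j i
extAdj-sym n d i j with i ≟ j | j ≟ i
... | yes refl | yes _ = refl
... | yes refl | no ¬p = Data.Empty.⊥-elim (¬p refl)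
  where import Data.Empty
... | no ¬p | yes refl = Data.Empty.⊥-elim (¬p refl)
  where import Data.Empty
... | no _ | no _ = rel-sym (cls n d (toℕ i)) (cls n d (toℕ j))

extAdj-irr : ∀ n d i → extAdj n d i i ≡ false
extAdj-irr n d i with i ≟ i
... | yes _ = refl
... | no ¬p = Data.Empty.⊥-elim (¬p refl)
  where import Data.Empty

Extremal : (n d : ℕ) → Graph n
Extremal n d = record { adj = extAdj n d ; adj-sym = extAdj-sym n d ; adj-irr = extAdj-irr n d }

{-# OPTIONS --safe #-}
-- G is in fact Hamiltonian, and a Hamiltonian cycle is an even factor. Double counting turns
-- e(G) ≥ e(K_δ ∨ (K_{n-2δ+1} ∪ (δ-1)K_1)) into a lower bound on the degree sum. Adding a
-- non-edge uv with d(u) + d(v) ≥ n does not change whether a graph is Hamiltonian (Ore's rotation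
-- argument, Bondy–Chvátal), and it preserves the minimum degree and the degree-sum bound; so it
-- suffices that every non-complete graph with these properties has such a non-edge. If not, take
-- a non-edge uv of maximal degree sum, i = d(u) ≤ d(v), d(u) + d(v) < n: as in Chvátal's theorem,
-- at least i vertices have degree ≤ i and at least n - i have degree ≤ n - 1 - i, which bounds the
-- degree sum by n(n-1) - i(n-i) - (n-1-2i)i, below the extremal value for even n ≥ 6δ - 4.
module Submission where

open import Defs
open import Data.Bool using (Bool; true; false; not; _∧_; _∨_; if_then_else_)
open import Data.Bool.Properties as Bool
  using (¬-not; not-injective; ∨-comm; ∧-comm; ∧-inverseʳ; ∨-inverseʳ; ∨-identityʳ; ∨-zeroʳ; ∧-zeroʳ; T-≡)
open import Data.Empty using (⊥-elim)
open import Data.Fin using (Fin; zero; suc; toℕ; fromℕ; fromℕ<; inject₁; _≟_)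
open import Data.Fin.Permutation using (Permutation′; permutation)
open import Data.Fin.Properties using (toℕ-injective; toℕ-fromℕ; toℕ-fromℕ<; toℕ-inject₁; toℕ<n; any?)
open import Data.List using (List; allFin; cartesianProduct)
open import Data.List.Extrema.Nat using (argmax; f[⊥]≤f[argmax]; f[xs]≤f[argmax])
open import Data.List.Membership.Propositional.Properties using (∈-allFin; ∈-cartesianProduct⁺)
open import Data.List.Relation.Unary.All using (lookup)
open import Data.Nat
  using (ℕ; zero; suc; NonZero; z≤n; s≤s; z<s; s≤s⁻¹; _+_; _*_; _∸_; _≤_; _<_; _≤ᵇ_; _<ᵇ_; _≤?_)
open import Data.Nat.DivMod using (_mod_; m<n⇒m%n≡m)
open import Data.Nat.Divisibility using (_∣_; divides)
open import Data.Nat.Properties hiding (_≟_)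
open import Data.Nat.Solver using (module +-*-Solver)
open import Data.Product using (Σ; ∃; _×_; _,_; proj₁; proj₂)
open import Data.Sum using (_⊎_; inj₁; inj₂)
open import Function using (_∘_; Equivalence)
open import Relation.Binary using (tri<; tri≈; tri>)
open import Relation.Binary.PropositionalEquality
open import Relation.Nullary using (¬_; ¬?; Dec; does; yes; no; _×-dec_)
open import Relation.Nullary.Decidable using (dec-true; dec-false)

open import Algebra.Properties.CommutativeSemigroup +-commutativeSemigroup
  using () renaming (interchange to +-interchange)
open import Algebra.Properties.CommutativeMonoid.Sum +-0-commutativeMonoid using (sum; ∑-permute)
open +-*-Solver using (solve; _:+_; _:*_; _:=_; con)

iverson : Bool → ℕ
iverson b = if b then 1 else 0

_==_ : ∀ {n} → Fin n → Fin n → Bool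
a == b = does (a ≟ b)

sumFin≡sum : ∀ {n} (f : Fin n → ℕ) → sumFin f ≡ sum f
sumFin≡sum {zero}  f = refl
sumFin≡sum {suc n} f = cong (f zero +_) (sumFin≡sum (f ∘ suc))

sumFin-cong : ∀ {n} {f g : Fin n → ℕ} → f ≗ g → sumFin f ≡ sumFin g
sumFin-cong {zero}  f≗g = refl
sumFin-cong {suc n} f≗g = cong₂ _+_ (f≗g zero) (sumFin-cong (f≗g ∘ suc))

sumFin-mono : ∀ {n} {f g : Fin n → ℕ} → (∀ a → f a ≤ g a) → sumFin f ≤ sumFin g
sumFin-mono {zero}  f≤g = z≤n
sumFin-mono {suc n} f≤g = +-mono-≤ (f≤g zero) (sumFin-mono (f≤g ∘ suc))

sumFin-mono-< : ∀ {n} {f g : Fin n → ℕ} → (∀ a → f a ≤ g a) → ∀ c → f c < g c → sumFin f < sumFin g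
sumFin-mono-< {suc n} f≤g zero    fc<gc = +-mono-<-≤ fc<gc (sumFin-mono (f≤g ∘ suc))
sumFin-mono-< {suc n} f≤g (suc c) fc<gc = +-mono-≤-< (f≤g zero) (sumFin-mono-< (f≤g ∘ suc) c fc<gc)

sumFin-const : ∀ n c → sumFin {n} (λ _ → c) ≡ n * c
sumFin-const zero    c = refl
sumFin-const (suc n) c = cong (c +_) (sumFin-const n c)

sumFin-+ : ∀ {n} (f g : Fin n → ℕ) → sumFin (λ a → f a + g a) ≡ sumFin f + sumFin g
sumFin-+ {zero}  f g = refl
sumFin-+ {suc n} f g =
  trans (cong (f zero + g zero +_) (sumFin-+ (f ∘ suc) (g ∘ suc))) (+-interchange (f zero) (g zero) _ _)

sumFin-zero : ∀ n → sumFin {n} (λ _ → 0) ≡ 0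
sumFin-zero n = trans (sumFin-const n 0) (*-zeroʳ n)

sumFin-comm : ∀ {m n} (f : Fin m → Fin n → ℕ) →
  sumFin (λ a → sumFin (f a)) ≡ sumFin (λ b → sumFin (λ a → f a b))
sumFin-comm {zero}  {n} f = sym (sumFin-zero n)
sumFin-comm {suc m} f =
  trans (cong (sumFin (f zero) +_) (sumFin-comm (f ∘ suc))) (sym (sumFin-+ (f zero) _))

countTrue≡sumFin : ∀ {n} (f : Fin n → Bool) → countTrue f ≡ sumFin (iverson ∘ f)
countTrue≡sumFin {zero}  f = refl
countTrue≡sumFin {suc n} f = cong (iverson (f zero) +_) (countTrue≡sumFin (f ∘ suc))

sumFin-if : ∀ {n} k (f : Fin n → Bool) → sumFin (λ a → if f a then k else 0) ≡ k * countTrue f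
sumFin-if {zero}  k f = sym (*-zeroʳ k)
sumFin-if {suc n} k f with f zero
... | true  = trans (cong (k +_) (sumFin-if k (f ∘ suc))) (sym (*-suc k _))
... | false = sumFin-if k (f ∘ suc)

countTrue-cong : ∀ {n} {f g : Fin n → Bool} → f ≗ g → countTrue f ≡ countTrue g
countTrue-cong {zero}  f≗g = refl
countTrue-cong {suc n} f≗g = cong₂ _+_ (cong iverson (f≗g zero)) (countTrue-cong (f≗g ∘ suc))

iverson-mono : ∀ {b c} → (b ≡ true → c ≡ true) → iverson b ≤ iverson c
iverson-mono {false}         b⇒c = z≤n
iverson-mono {true}  {true}  b⇒c = ≤-refl
iverson-mono {true}  {false} b⇒c with () ← b⇒c refl

countTrue-mono : ∀ {n} {f g : Fin n → Bool} → (∀ a → f a ≡ true → g a ≡ true) → countTrue f ≤ countTrue g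
countTrue-mono {f = f} {g} f⇒g = subst₂ _≤_ (sym (countTrue≡sumFin f)) (sym (countTrue≡sumFin g))
  (sumFin-mono (λ a → iverson-mono (f⇒g a)))

countTrue-mono-< : ∀ {n} {f g : Fin n → Bool} → (∀ a → f a ≡ true → g a ≡ true) →
  ∀ c → f c ≡ false → g c ≡ true → countTrue f < countTrue g
countTrue-mono-< {f = f} {g} f⇒g c fc gc = subst₂ _<_ (sym (countTrue≡sumFin f)) (sym (countTrue≡sumFin g))
  (sumFin-mono-< (λ a → iverson-mono (f⇒g a)) c
                 (subst₂ (λ x y → iverson x < iverson y) (sym fc) (sym gc) ≤-refl))

countTrue-false : ∀ {n} (f : Fin n → Bool) → (∀ a → f a ≡ false) → countTrue f ≡ 0
countTrue-false {zero}  f f≡false = refl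
countTrue-false {suc n} f f≡false rewrite f≡false zero = countTrue-false (f ∘ suc) (f≡false ∘ suc)

iverson-∨ : ∀ b c → b ∧ c ≡ false → iverson (b ∨ c) ≡ iverson b + iverson c
iverson-∨ false c     _ = refl
iverson-∨ true  false _ = refl

countTrue-∨ : ∀ {n} (f g : Fin n → Bool) → (∀ a → f a ∧ g a ≡ false) →
  countTrue (λ a → f a ∨ g a) ≡ countTrue f + countTrue g
countTrue-∨ {zero}  f g disjoint = refl
countTrue-∨ {suc n} f g disjoint =
  trans (cong₂ _+_ (iverson-∨ (f zero) (g zero) (disjoint zero)) (countTrue-∨ (f ∘ suc) (g ∘ suc) (disjoint ∘ suc)))
        (+-interchange (iverson (f zero)) _ _ _)

countTrue-true : ∀ {n} {f : Fin n → Bool} → (∀ a → f a ≡ true) → countTrue f ≡ n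
countTrue-true {zero}  f≡true = refl
countTrue-true {suc n} {f} f≡true rewrite f≡true zero = cong suc (countTrue-true (f≡true ∘ suc))

countTrue-not : ∀ {n} (f : Fin n → Bool) → countTrue f + countTrue (not ∘ f) ≡ n
countTrue-not f = trans (sym (countTrue-∨ f (not ∘ f) (λ a → ∧-inverseʳ (f a))))
  (countTrue-true (λ a → ∨-inverseʳ (f a)))

countTrue≤n : ∀ {n} (f : Fin n → Bool) → countTrue f ≤ n
countTrue≤n f = subst (countTrue f ≤_) (countTrue-not f) (m≤m+n _ _)

countTrue-init-last : ∀ {m} (f : Fin (suc m) → Bool) →
  countTrue f ≡ countTrue (f ∘ inject₁) + iverson (f (fromℕ m))
countTrue-init-last {zero}  f = +-comm (iverson (f zero)) 0
countTrue-init-last {suc m} f =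
  trans (cong (iverson (f zero) +_) (countTrue-init-last (f ∘ suc))) (sym (+-assoc (iverson (f zero)) _ _))

countTrue-== : ∀ {n} (b : Fin n) → countTrue (_== b) ≡ 1
countTrue-== {suc n} zero = cong suc (countTrue-false {n} _ (λ _ → refl))
countTrue-== {suc n} (suc b) = countTrue-== b

countTrue-<ᵇ : ∀ {n} k → k ≤ n → countTrue {n} (λ j → toℕ j <ᵇ k) ≡ k
countTrue-<ᵇ {n}     zero    _         = countTrue-false {n} _ (λ _ → refl)
countTrue-<ᵇ {suc n} (suc k) (s≤s k≤n) = cong suc (countTrue-<ᵇ k k≤n)

countTrue-remove : ∀ {n} (v : Fin n) (f : Fin n → Bool) →
  countTrue (λ a → not (v == a) ∧ f a) + iverson (f v) ≡ countTrue f
countTrue-remove zero    f = +-comm (countTrue (f ∘ suc)) _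
countTrue-remove (suc v) f =
  trans (+-assoc (iverson (f zero)) _ _) (cong (iverson (f zero) +_) (countTrue-remove v (f ∘ suc)))

<ᵇ-true : ∀ {m n} → m < n → (m <ᵇ n) ≡ true
<ᵇ-true m<n = Equivalence.to T-≡ (<⇒<ᵇ m<n)

<ᵇ-false : ∀ {m n} → n ≤ m → (m <ᵇ n) ≡ false
<ᵇ-false {m} {n} n≤m with m <ᵇ n in m<ᵇn
... | false = refl
... | true  = ⊥-elim (≤⇒≯ n≤m (<ᵇ⇒< m n (Equivalence.from T-≡ m<ᵇn)))

≤ᵇ-true : ∀ {m n} → m ≤ n → (m ≤ᵇ n) ≡ true
≤ᵇ-true m≤n = Equivalence.to T-≡ (≤⇒≤ᵇ m≤n)

≤ᵇ-false : ∀ {m n} → n < m → (m ≤ᵇ n) ≡ false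
≤ᵇ-false {m} {n} n<m with m ≤ᵇ n in m≤ᵇn
... | false = refl
... | true  = ⊥-elim (<⇒≱ n<m (≤ᵇ⇒≤ m n (Equivalence.from T-≡ m≤ᵇn)))

∧-true : ∀ {x y} → x ∧ y ≡ true → x ≡ true × y ≡ true
∧-true {true} {true} _ = refl , refl

-- Degrees and edges

degreeSum : ∀ {n} → Graph n → ℕ
degreeSum H = sumFin (deg H)

deg<n : ∀ {n} (H : Graph n) a → deg H a < n
deg<n H a = subst (deg H a <_) (countTrue-true {f = λ _ → true} (λ _ → refl))
  (countTrue-mono-< (λ _ _ → refl) a (adj-irr H a) refl)

module _ {n} (H : Graph n) where

  private
    below : Fin n → Fin n → Bool
    below i j = toℕ i <ᵇ toℕ j

    split-by-order : ∀ i j → adj H i j ≡ (below i j ∧ adj H i j) ∨ (below j i ∧ adj H i j)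
    split-by-order i j with <-cmp (toℕ i) (toℕ j)
    ... | tri< i<j _ _ rewrite <ᵇ-true i<j | <ᵇ-false {toℕ j} (<⇒≤ i<j) = sym (∨-identityʳ _)
    ... | tri> _ _ j<i rewrite <ᵇ-false {toℕ i} (<⇒≤ j<i) | <ᵇ-true j<i = refl
    ... | tri≈ _ i≡j _ rewrite toℕ-injective i≡j | adj-irr H j | <ᵇ-false {toℕ j} ≤-refl = refl

    order-disjoint : ∀ i j → (below i j ∧ adj H i j) ∧ (below j i ∧ adj H i j) ≡ false
    order-disjoint i j with <-cmp (toℕ i) (toℕ j)
    ... | tri< i<j _ _ rewrite <ᵇ-false {toℕ j} (<⇒≤ i<j) = ∧-zeroʳ _
    ... | tri≈ _ i≡j _ rewrite toℕ-injective i≡j | <ᵇ-false {toℕ j} ≤-refl = refl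
    ... | tri> _ _ j<i rewrite <ᵇ-false {toℕ i} (<⇒≤ j<i) = refl

    edges-from-above : sumFin (λ i → countTrue (λ j → below j i ∧ adj H i j)) ≡ e H
    edges-from-above = begin
      sumFin (λ i → countTrue (λ j → below j i ∧ adj H i j))
        ≡⟨ sumFin-cong {n} (λ i → countTrue≡sumFin {n} _) ⟩
      sumFin (λ i → sumFin (λ j → iverson (below j i ∧ adj H i j)))
        ≡⟨ sumFin-comm {n} {n} _ ⟩
      sumFin (λ j → sumFin (λ i → iverson (below j i ∧ adj H i j)))
        ≡⟨ sumFin-cong {n} (λ j → sumFin-cong {n} (λ i → cong (iverson ∘ (below j i ∧_)) (adj-sym H i j))) ⟩
      sumFin (λ j → sumFin (λ i → iverson (below j i ∧ adj H j i)))
        ≡⟨ sumFin-cong {n} (λ j → countTrue≡sumFin {n} _) ⟨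
      e H ∎
      where open ≡-Reasoning

  degreeSum≡e+e : degreeSum H ≡ e H + e H
  degreeSum≡e+e = begin
    sumFin (deg H)
      ≡⟨ sumFin-cong {n} (λ i → trans (countTrue-cong (split-by-order i)) (countTrue-∨ _ _ (order-disjoint i))) ⟩
    sumFin (λ i → countTrue (λ j → below i j ∧ adj H i j) + countTrue (λ j → below j i ∧ adj H i j))
      ≡⟨ sumFin-+ {n} _ _ ⟩
    e H + sumFin (λ i → countTrue (λ j → below j i ∧ adj H i j))
      ≡⟨ cong (e H +_) edges-from-above ⟩
    e H + e H ∎
    where open ≡-Reasoning

NonEdge : ∀ {n} → Graph n → Fin n → Fin n → Set
NonEdge H u v = u ≢ v × adj H u v ≡ false

nonEdge? : ∀ {n} (H : Graph n) x y → Dec (NonEdge H x y)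
nonEdge? H x y = ¬? (x ≟ y) ×-dec (adj H x y Bool.≟ false)

NonEdge-sym : ∀ {n} {H : Graph n} {u v} → NonEdge H u v → NonEdge H v u
NonEdge-sym {H = H} (u≢v , uv) = u≢v ∘ sym , trans (adj-sym H _ _) uv

OrePair : ∀ {n} → Graph n → Fin n → Fin n → Set
OrePair {n} H u v = NonEdge H u v × n ≤ deg H u + deg H v

SamePair : ∀ {n} → Fin n → Fin n → Fin n → Fin n → Set
SamePair u v a b = (a ≡ u × b ≡ v) ⊎ (a ≡ v × b ≡ u)

module _ {n} (H : Graph n) {u v : Fin n} (u≢v : u ≢ v) where

  private
    joins : Fin n → Fin n → Bool
    joins a b = (a == u ∧ b == v) ∨ (a == v ∧ b == u)

    joins-sym : ∀ a b → joins a b ≡ joins b a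
    joins-sym a b = trans (∨-comm (a == u ∧ b == v) _) (cong₂ _∨_ (∧-comm (a == v) _) (∧-comm (a == u) _))

    joins-irr : ∀ a → joins a a ≡ false
    joins-irr a with a ≟ u | a ≟ v
    ... | yes refl | yes refl = ⊥-elim (u≢v refl)
    ... | yes _    | no _     = refl
    ... | no _     | yes _    = refl
    ... | no _     | no _     = refl

    joins-sound : ∀ a b → joins a b ≡ true → SamePair u v a b
    joins-sound a b ab with a ≟ u | b ≟ v | a ≟ v | b ≟ u
    ... | yes a≡u | yes b≡v | _       | _       = inj₁ (a≡u , b≡v)
    ... | _       | _       | yes a≡v | yes b≡u = inj₂ (a≡v , b≡u)
    ... | yes _   | no _    | yes _   | no _    with () ← ab
    ... | yes _   | no _    | no _    | _       with () ← ab
    ... | no _    | _       | yes _   | no _    with () ← ab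
    ... | no _    | _       | no _    | _       with () ← ab

  addEdge : Graph n
  addEdge = record
    { adj     = λ a b → adj H a b ∨ joins a b
    ; adj-sym = λ a b → cong₂ _∨_ (adj-sym H a b) (joins-sym a b)
    ; adj-irr = λ a → cong₂ _∨_ (adj-irr H a) (joins-irr a)
    }

  addEdge-⊇ : Subgraph H addEdge
  addEdge-⊇ a b ab rewrite ab = refl

  addEdge-joins : adj addEdge u v ≡ true
  addEdge-joins rewrite dec-true (u ≟ u) refl | dec-true (v ≟ v) refl = ∨-zeroʳ (adj H u v)

  addEdge-⁻ : ∀ a b → adj addEdge a b ≡ true → adj H a b ≡ true ⊎ SamePair u v a b
  addEdge-⁻ a b ab with adj H a b
  ... | true  = inj₁ refl
  ... | false = inj₂ (joins-sound a b ab)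

  deg-addEdge : ∀ a → deg H a ≤ deg addEdge a
  deg-addEdge a = countTrue-mono (addEdge-⊇ a)

  degreeSum-addEdge : adj H u v ≡ false → degreeSum H < degreeSum addEdge
  degreeSum-addEdge uv = sumFin-mono-< deg-addEdge u (countTrue-mono-< (addEdge-⊇ u) v uv addEdge-joins)

-- Hamiltonian cycles

-- Positions are natural numbers below n, so that rotating or reflecting a cycle is ℕ arithmetic.
record Arrangement (n : ℕ) : Set where
  field
    at          : ℕ → Fin n
    position    : Fin n → ℕ
    position<   : ∀ a → position a < n
    at-position : ∀ a → at (position a) ≡ a
    position-at : ∀ {k} → k < n → position (at k) ≡ k

  at-injective : ∀ {k l} → k < n → l < n → at k ≡ at l → k ≡ l
  at-injective k<n l<n eq = trans (sym (position-at k<n)) (trans (cong position eq) (position-at l<n))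

  at′ : Fin n → Fin n
  at′ k = at (toℕ k)

  asPermutation : Permutation′ n
  asPermutation = permutation at′ (λ a → fromℕ< (position< a))
    (λ a → trans (cong at (toℕ-fromℕ< (position< a))) (at-position a))
    (λ k → toℕ-injective (trans (toℕ-fromℕ< _) (position-at (toℕ<n k))))

  countTrue-along : (f : Fin n → Bool) → countTrue (f ∘ at′) ≡ countTrue f
  countTrue-along f = begin
    countTrue (f ∘ at′)         ≡⟨ countTrue≡sumFin (f ∘ at′) ⟩
    sumFin (iverson ∘ f ∘ at′)  ≡⟨ sumFin≡sum (iverson ∘ f ∘ at′) ⟩
    sum (iverson ∘ f ∘ at′)     ≡⟨ ∑-permute (iverson ∘ f) asPermutation ⟨
    sum (iverson ∘ f)           ≡⟨ sumFin≡sum (iverson ∘ f) ⟨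
    sumFin (iverson ∘ f)        ≡⟨ countTrue≡sumFin f ⟨
    countTrue f                 ∎
    where open ≡-Reasoning

open Arrangement public

record Reindexing (n : ℕ) : Set where
  field
    to      : ℕ → ℕ
    from    : ℕ → ℕ
    to<     : ∀ {k} → k < n → to k < n
    from<   : ∀ {k} → k < n → from k < n
    to-from : ∀ {k} → k < n → to (from k) ≡ k
    from-to : ∀ {k} → k < n → from (to k) ≡ k

involution : ∀ {n} (φ : ℕ → ℕ) → (∀ {k} → k < n → φ k < n) → (∀ {k} → k < n → φ (φ k) ≡ k) → Reindexing n
involution φ φ< φφ = record { to = φ ; from = φ ; to< = φ< ; from< = φ< ; to-from = φφ ; from-to = φφ }

reindex : ∀ {n} → Arrangement n → Reindexing n → Arrangement n
reindex S ρ = record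
  { at          = at S ∘ to
  ; position    = from ∘ position S
  ; position<   = λ a → from< (position< S a)
  ; at-position = λ a → trans (cong (at S) (to-from (position< S a))) (at-position S a)
  ; position-at = λ k<n → trans (cong from (position-at S (to< k<n))) (from-to k<n)
  }
  where open Reindexing ρ

next : ℕ → ℕ → ℕ
next n k = if suc k <ᵇ n then suc k else 0

prev : ℕ → ℕ → ℕ
prev n zero    = n ∸ 1
prev n (suc k) = k

next-suc : ∀ {n k} → suc k < n → next n k ≡ suc k
next-suc {n} {k} k+1<n rewrite <ᵇ-true k+1<n = refl

next-last : ∀ {n k} → suc k ≡ n → next n k ≡ 0
next-last {k = k} refl rewrite <ᵇ-false {suc k} ≤-refl = refl

next< : ∀ {n k} → k < n → next n k < n
next< {n} {k} k<n with m≤n⇒m<n∨m≡n k<n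
... | inj₁ k+1<n = subst (_< n) (sym (next-suc k+1<n)) k+1<n
... | inj₂ k+1≡n = subst (_< n) (sym (next-last k+1≡n)) (≤-trans (s≤s z≤n) k<n)

prev< : ∀ {n k} → k < n → prev n k < n
prev< {suc n} {zero}  _   = n<1+n n
prev< {n}     {suc k} k<n = <-trans (n<1+n k) k<n

prev-next : ∀ {n k} → k < n → prev n (next n k) ≡ k
prev-next {n} {k} k<n with m≤n⇒m<n∨m≡n k<n
... | inj₁ k+1<n = cong (prev n) (next-suc k+1<n)
... | inj₂ refl  = cong (prev (suc k)) (next-last {k = k} refl)

next-prev : ∀ {n k} → k < n → next n (prev n k) ≡ k
next-prev {suc n} {zero}  _   = next-last refl
next-prev {n}     {suc k} k<n = next-suc k<n

next≢prev : ∀ {n k} → 3 ≤ n → k < n → next n k ≢ prev n k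
next≢prev {n} {zero} 3≤n _ next≡prev =
  <⇒≢ (∸-monoˡ-≤ 1 3≤n) (trans (sym (next-suc (≤-trans (s≤s (s≤s z≤n)) 3≤n))) next≡prev)
next≢prev {n} {suc j} 3≤n k<n next≡prev with m≤n⇒m<n∨m≡n k<n
... | inj₁ k+1<n = <⇒≢ (m<n⇒m<1+n (n<1+n j)) (sym (trans (sym (next-suc k+1<n)) next≡prev))
... | inj₂ refl  with trans (sym (next-last {k = suc j} refl)) next≡prev
...   | refl = ≤⇒≯ 3≤n ≤-refl

rotation : ∀ {n} → Reindexing n
rotation {n} = record
  { to = next n ; from = prev n ; to< = next< ; from< = prev< ; to-from = next-prev ; from-to = prev-next }

HamPath : ∀ {n} → Graph n → Arrangement n → Set
HamPath {n} H S = ∀ {k} → suc k < n → adj H (at S k) (at S (suc k)) ≡ true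

HamCycle : ∀ {n} → Graph n → Arrangement n → Set
HamCycle {n} H S = ∀ {k} → k < n → adj H (at S k) (at S (next n k)) ≡ true

Hamiltonian : ∀ {n} → Graph n → Set
Hamiltonian {n} H = Σ (Arrangement n) (HamCycle H)

rotate-HamCycle : ∀ {n} {H : Graph n} {S} → HamCycle H S → HamCycle H (reindex S rotation)
rotate-HamCycle cycle k<n = cycle (next< k<n)

rotateTo : ∀ {n} {H : Graph n} {S} → HamCycle H S → ∀ a → Σ (Arrangement n) λ T → HamCycle H T × at T 0 ≡ a
rotateTo {n} {H} {S} cycle a = go (position S a) S cycle refl
  where
  go : ∀ t S → HamCycle H S → position S a ≡ t → Σ (Arrangement n) λ T → HamCycle H T × at T 0 ≡ a
  go zero    S cycle pos≡0 = S , cycle , trans (cong (at S) (sym pos≡0)) (at-position S a)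
  go (suc t) S cycle pos≡t = go t (reindex S rotation) (rotate-HamCycle {H = H} {S = S} cycle) (cong (prev n) pos≡t)

module _ {n} {H : Graph n} (3≤n : 3 ≤ n) (S : Arrangement n) (cycle : HamCycle H S) where

  private
    succ pred : Fin n → Fin n
    succ a = at S (next n (position S a))
    pred a = at S (prev n (position S a))

    succ-pred : ∀ a → succ (pred a) ≡ a
    succ-pred a = trans (cong (at S ∘ next n) (position-at S (prev< (position< S a))))
                        (trans (cong (at S) (next-prev (position< S a))) (at-position S a))

    pred-succ : ∀ a → pred (succ a) ≡ a
    pred-succ a = trans (cong (at S ∘ prev n) (position-at S (next< (position< S a))))
                        (trans (cong (at S) (prev-next (position< S a))) (at-position S a))

    adj-succ : ∀ a → adj H a (succ a) ≡ true
    adj-succ a = subst (λ b → adj H b (succ a) ≡ true) (at-position S a) (cycle (position< S a))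

    succ≢pred : ∀ a → succ a ≢ pred a
    succ≢pred a = next≢prev 3≤n (position< S a)
                ∘ at-injective S (next< (position< S a)) (prev< (position< S a))

    ≢succ : ∀ a → a ≢ succ a
    ≢succ a a≡succ with () ← trans (sym (adj-irr H a)) (subst (λ b → adj H a b ≡ true) (sym a≡succ) (adj-succ a))

    ==succ≡==pred : ∀ a b → (a == succ b) ≡ (b == pred a)
    ==succ≡==pred a b with a ≟ succ b | b ≟ pred a
    ... | yes _     | yes _ = refl
    ... | no _      | no _  = refl
    ... | yes a≡sb  | no b≢pa = ⊥-elim (b≢pa (trans (sym (pred-succ b)) (cong pred (sym a≡sb))))
    ... | no a≢sb   | yes b≡pa = ⊥-elim (a≢sb (trans (sym (succ-pred a)) (cong succ (sym b≡pa))))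

    cycleGraph : Graph n
    cycleGraph = record
      { adj     = λ a b → (b == succ a) ∨ (a == succ b)
      ; adj-sym = λ a b → ∨-comm (b == succ a) _
      ; adj-irr = λ a → cong₂ _∨_ (dec-false (a ≟ succ a) (≢succ a)) (dec-false (a ≟ succ a) (≢succ a))
      }

    cycleGraph-⊆ : Subgraph cycleGraph H
    cycleGraph-⊆ a b ab with b ≟ succ a | a ≟ succ b
    ... | yes refl | _        = adj-succ a
    ... | no _     | yes refl = trans (adj-sym H _ _) (adj-succ b)

    deg-cycleGraph : ∀ a → deg cycleGraph a ≡ 2
    deg-cycleGraph a = begin
      countTrue (λ b → (b == succ a) ∨ (a == succ b))
        ≡⟨ countTrue-cong (λ b → cong ((b == succ a) ∨_) (==succ≡==pred a b)) ⟩
      countTrue (λ b → (b == succ a) ∨ (b == pred a))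
        ≡⟨ countTrue-∨ (_== succ a) (_== pred a) disjoint ⟩
      countTrue (_== succ a) + countTrue (_== pred a)
        ≡⟨ cong₂ _+_ (countTrue-== (succ a)) (countTrue-== (pred a)) ⟩
      2 ∎
      where
      open ≡-Reasoning
      disjoint : ∀ b → (b == succ a) ∧ (b == pred a) ≡ false
      disjoint b with b ≟ succ a | b ≟ pred a
      ... | yes refl | yes b≡pa = ⊥-elim (succ≢pred a b≡pa)
      ... | yes _    | no _     = refl
      ... | no _     | _        = refl

  HamCycle⇒evenFactor : HasEvenFactor H
  HamCycle⇒evenFactor = cycleGraph , cycleGraph-⊆ ,
    λ a → subst (λ d → 2 ≤ d × 2 ∣ d) (sym (deg-cycleGraph a)) (≤-refl , divides 1 refl)

hamiltonian⇒evenFactor : ∀ {n} {H : Graph n} → 3 ≤ n → Hamiltonian H → HasEvenFactor H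
hamiltonian⇒evenFactor {H = H} 3≤n (S , cycle) = HamCycle⇒evenFactor {H = H} 3≤n S cycle

-- Ore's lemma and the Bondy–Chvátal closure

module ReflectAfter (n J : ℕ) where

  reflectAfter : ℕ → ℕ
  reflectAfter k = if k ≤ᵇ J then k else J + (n ∸ k)

  reflectAfter-≤ : ∀ {k} → k ≤ J → reflectAfter k ≡ k
  reflectAfter-≤ k≤J rewrite ≤ᵇ-true k≤J = refl

  reflectAfter-> : ∀ {k} → J < k → reflectAfter k ≡ J + (n ∸ k)
  reflectAfter-> J<k rewrite ≤ᵇ-false J<k = refl

  reflectAfter>J : ∀ {k} → J < k → k < n → J < reflectAfter k
  reflectAfter>J J<k k<n = subst (J <_) (sym (reflectAfter-> J<k)) (m<m+n J (m<n⇒0<n∸m k<n))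

  reflectAfter< : ∀ {k} → k < n → reflectAfter k < n
  reflectAfter< {k} k<n with k ≤? J
  ... | yes k≤J = subst (_< n) (sym (reflectAfter-≤ k≤J)) k<n
  ... | no  k≰J = begin-strict
    reflectAfter k ≡⟨ reflectAfter-> J<k ⟩
    J + (n ∸ k)    <⟨ +-monoʳ-< J (∸-monoʳ-< J<k (<⇒≤ k<n)) ⟩
    J + (n ∸ J)    ≡⟨ m+[n∸m]≡n (<⇒≤ (<-trans J<k k<n)) ⟩
    n              ∎
    where
    open ≤-Reasoning
    J<k : J < k
    J<k = ≰⇒> k≰J

  reflectAfter-involutive : ∀ {k} → k < n → reflectAfter (reflectAfter k) ≡ k
  reflectAfter-involutive {k} k<n with k ≤? J
  ... | yes k≤J = trans (cong reflectAfter (reflectAfter-≤ k≤J)) (reflectAfter-≤ k≤J)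
  ... | no  k≰J = begin
    reflectAfter (reflectAfter k) ≡⟨ reflectAfter-> (reflectAfter>J J<k k<n) ⟩
    J + (n ∸ reflectAfter k)      ≡⟨ cong (λ r → J + (n ∸ r)) (trans (reflectAfter-> J<k) (+-comm J _)) ⟩
    J + (n ∸ ((n ∸ k) + J))       ≡⟨ cong (J +_) (∸-+-assoc n (n ∸ k) J) ⟨
    J + (n ∸ (n ∸ k) ∸ J)         ≡⟨ cong (λ r → J + (r ∸ J)) (m∸[m∸n]≡n (<⇒≤ k<n)) ⟩
    J + (k ∸ J)                   ≡⟨ m+[n∸m]≡n (<⇒≤ J<k) ⟩
    k                             ∎
    where
    open ≡-Reasoning
    J<k : J < k
    J<k = ≰⇒> k≰J

reverseAfter : ∀ {n} J → Reindexing n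
reverseAfter {n} J = involution reflectAfter reflectAfter< reflectAfter-involutive
  where open ReflectAfter n J

module _ {m} (H : Graph (suc m)) (S : Arrangement (suc m)) (path : HamPath H S) where

  private
    edge : ∀ {k l p q} → p ≡ k → q ≡ l → adj H (at S k) (at S l) ≡ true → adj H (at S p) (at S q) ≡ true
    edge refl refl kl = kl

    redge : ∀ {k l p q} → p ≡ k → q ≡ l → adj H (at S l) (at S k) ≡ true → adj H (at S p) (at S q) ≡ true
    redge p≡k q≡l lk = edge p≡k q≡l (trans (adj-sym H _ _) lk)

  module _ {J} (J<m : J < m) (mJ : adj H (at S m) (at S J) ≡ true) (0J : adj H (at S 0) (at S (suc J)) ≡ true) where

    open ReflectAfter (suc m) J

    ore-cycle : HamCycle H (reindex S (reverseAfter J))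
    ore-cycle {k} k<n with m≤n⇒m<n∨m≡n k<n
    ... | inj₂ refl = redge φm≡1+J φ0≡0 0J
      where
      φm≡1+J : reflectAfter m ≡ suc J
      φm≡1+J = trans (reflectAfter-> J<m) (trans (cong (J +_) (m+n∸n≡m 1 m)) (+-comm J 1))
      φ0≡0 : reflectAfter (next (suc m) m) ≡ 0
      φ0≡0 = trans (cong reflectAfter (next-last {k = m} refl)) (reflectAfter-≤ z≤n)
    ... | inj₁ (s≤s k<m) with <-cmp k J
    ...   | tri< k<J _ _  = edge (reflectAfter-≤ (<⇒≤ k<J))
                                 (trans (cong reflectAfter (next-suc (s≤s k<m))) (reflectAfter-≤ k<J))
                                 (path (s≤s k<m))
    ...   | tri≈ _ refl _ = redge (reflectAfter-≤ ≤-refl) φ1+J≡m mJ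
      where
      φ1+J≡m : reflectAfter (next (suc m) J) ≡ m
      φ1+J≡m = trans (cong reflectAfter (next-suc (s≤s k<m))) (trans (reflectAfter-> ≤-refl) (m+[n∸m]≡n (<⇒≤ J<m)))
    ...   | tri> _ _ J<k  = redge φk≡1+p
                                  (trans (cong reflectAfter (next-suc (s≤s k<m))) (reflectAfter-> (m<n⇒m<1+n J<k)))
                                  (path (subst (_< suc m) φk≡1+p (reflectAfter< k<n)))
      where
      φk≡1+p : reflectAfter k ≡ suc (J + (m ∸ k))
      φk≡1+p = trans (reflectAfter-> J<k) (trans (cong (J +_) (+-∸-assoc 1 (<⇒≤ k<m))) (+-suc J (m ∸ k)))

module _ {m} (H : Graph (suc m)) (S : Arrangement (suc m)) where

  private
    a b : Fin (suc m)
    a = at S 0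
    b = at S m

    a-before b-at : Fin m → Bool
    a-before k = adj H a (at S (suc (toℕ k)))
    b-at     k = adj H b (at S (toℕ k))

    deg-first : deg H a ≡ countTrue a-before
    deg-first = begin
      deg H a                       ≡⟨ countTrue-along S (adj H a) ⟨
      countTrue (adj H a ∘ at′ S)   ≡⟨ cong (_+ countTrue a-before) (cong iverson (adj-irr H a)) ⟩
      countTrue a-before            ∎
      where open ≡-Reasoning

    deg-last : deg H b ≡ countTrue b-at
    deg-last = begin
      deg H b                                                     ≡⟨ countTrue-along S (adj H b) ⟨
      countTrue (adj H b ∘ at′ S)                                 ≡⟨ countTrue-init-last (adj H b ∘ at′ S) ⟩
      countTrue (adj H b ∘ at′ S ∘ inject₁) + iverson (adj H b (at S (toℕ (fromℕ m))))
        ≡⟨ cong₂ _+_ (countTrue-cong {m} (cong (adj H b ∘ at S) ∘ toℕ-inject₁))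
                     (cong (iverson ∘ adj H b ∘ at S) (toℕ-fromℕ m)) ⟩
      countTrue b-at + iverson (adj H b b)                        ≡⟨ cong (λ x → countTrue b-at + iverson x) (adj-irr H b) ⟩
      countTrue b-at + 0                                          ≡⟨ +-identityʳ _ ⟩
      countTrue b-at                                              ∎
      where open ≡-Reasoning

  ore-degree-bound : (∀ k → b-at k ∧ a-before k ≡ false) → deg H a + deg H b ≤ m
  ore-degree-bound noCrossing = begin
    deg H a + deg H b                         ≡⟨ cong₂ _+_ deg-first deg-last ⟩
    countTrue a-before + countTrue b-at
      ≡⟨ countTrue-∨ a-before b-at (λ k → trans (∧-comm (a-before k) _) (noCrossing k)) ⟨
    countTrue (λ k → a-before k ∨ b-at k)     ≤⟨ countTrue≤n _ ⟩
    m                                         ∎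
    where open ≤-Reasoning

  -- For the path a = x_0 … x_m = b, a position k with b ∼ x_k and a ∼ x_{k+1} closes it into
  -- the cycle x_0 … x_k x_m x_{m-1} … x_{k+1}; without one, the neighbours of a and of b occupy
  -- disjoint sets of the m positions.
  ore : HamPath H S → suc m ≤ deg H a + deg H b → Hamiltonian H
  ore path enough with any? (λ k → b-at k ∧ a-before k Bool.≟ true)
  ... | yes (J , crossing) = reindex S (reverseAfter (toℕ J)) ,
                             ore-cycle H S path (toℕ<n J) (proj₁ (∧-true crossing)) (proj₂ (∧-true crossing))
  ... | no noCrossing      = ⊥-elim (1+n≰n (≤-trans enough (ore-degree-bound (λ k → ¬-not (noCrossing ∘ (k ,_))))))

SamePair-match : ∀ {n} {u v x y x′ y′ : Fin n} → SamePair u v x y → SamePair u v x′ y′ →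
  (x ≡ x′ × y ≡ y′) ⊎ (x ≡ y′ × y ≡ x′)
SamePair-match (inj₁ (refl , refl)) (inj₁ (refl , refl)) = inj₁ (refl , refl)
SamePair-match (inj₁ (refl , refl)) (inj₂ (refl , refl)) = inj₂ (refl , refl)
SamePair-match (inj₂ (refl , refl)) (inj₁ (refl , refl)) = inj₂ (refl , refl)
SamePair-match (inj₂ (refl , refl)) (inj₂ (refl , refl)) = inj₁ (refl , refl)

module _ {m} (H : Graph (suc m)) {u v} (u≢v : u ≢ v) (3≤n : 3 ≤ suc m)
         (S : Arrangement (suc m)) (cycle : HamCycle (addEdge H u≢v) S) where

  private
    n : ℕ
    n = suc m

    m<n : m < n
    m<n = n<1+n m

    0<n : 0 < n
    0<n = s≤s z≤n

    path-edge : ∀ {k} → suc k < n → adj (addEdge H u≢v) (at S k) (at S (suc k)) ≡ true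
    path-edge {k} k+1<n = subst (λ l → adj (addEdge H u≢v) (at S k) (at S l) ≡ true) (next-suc k+1<n)
                                (cycle (<-trans (n<1+n k) k+1<n))

  HamCycle⇒HamPath : SamePair u v (at S 0) (at S m) → HamPath H S
  HamCycle⇒HamPath closing {k} k+1<n with addEdge-⁻ H u≢v _ _ (path-edge k+1<n)
  ... | inj₁ inH = inH
  ... | inj₂ uv with SamePair-match uv closing
  ...   | inj₁ (Sk≡S0 , Sk+1≡Sm) = ⊥-elim (≤⇒≯ (subst (λ x → 3 ≤ suc x) m≡1 3≤n) ≤-refl)
    where
    m≡1 : m ≡ 1
    m≡1 = trans (sym (at-injective S k+1<n m<n Sk+1≡Sm))
                (cong suc (at-injective S (<-trans (n<1+n k) k+1<n) 0<n Sk≡S0))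
  ...   | inj₂ (_ , Sk+1≡S0) with () ← at-injective S k+1<n 0<n Sk+1≡S0

  HamCycle-avoiding : at S 0 ≡ u → at S 1 ≢ v → at S m ≢ v → HamCycle H S
  HamCycle-avoiding S0≡u S1≢v Sm≢v {k} k<n with addEdge-⁻ H u≢v _ _ (cycle k<n)
  ... | inj₁ inH = inH
  ... | inj₂ (inj₁ (Sk≡u , Snext≡v)) = ⊥-elim (S1≢v (subst (λ l → at S l ≡ v) next≡1 Snext≡v))
    where
    next≡1 : next n k ≡ 1
    next≡1 = trans (cong (next n) (at-injective S k<n 0<n (trans Sk≡u (sym S0≡u))))
                   (next-suc (≤-trans (s≤s (s≤s z≤n)) 3≤n))
  ... | inj₂ (inj₂ (Sk≡v , Snext≡u)) = ⊥-elim (Sm≢v (subst (λ l → at S l ≡ v) k≡m Sk≡v))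
    where
    k≡m : k ≡ m
    k≡m = trans (sym (prev-next k<n)) (cong (prev n) (at-injective S (next< k<n) 0<n (trans Snext≡u (sym S0≡u))))

-- Rotate the cycle of H + uv to start at u. If v is its last or second vertex, dropping uv leaves
-- (after one more rotation in the second case) a Hamiltonian path of H between u and v, which Ore's
-- lemma closes; otherwise the cycle does not use uv.
bondy-chvátal : ∀ {n} (H : Graph n) {u v} (u≢v : u ≢ v) → 3 ≤ n →
  n ≤ deg H u + deg H v → Hamiltonian (addEdge H u≢v) → Hamiltonian H
bondy-chvátal {suc m} H {u} {v} u≢v 3≤n enough (S₀ , cycle₀)
  with rotateTo {H = addEdge H u≢v} {S = S₀} cycle₀ u
... | S , cycle , S0≡u with at S m ≟ v | at S 1 ≟ v
...   | yes Sm≡v | _        = ore H S (HamCycle⇒HamPath H u≢v 3≤n S cycle (inj₁ (S0≡u , Sm≡v)))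
                                  (subst₂ (λ x y → suc m ≤ deg H x + deg H y) (sym S0≡u) (sym Sm≡v) enough)
...   | no _     | yes S1≡v = ore H T (HamCycle⇒HamPath H u≢v 3≤n T (rotate-HamCycle {H = addEdge H u≢v} {S = S} cycle)
                                                                (inj₂ (T0≡v , Tm≡u)))
                                  (subst₂ (λ x y → suc m ≤ deg H x + deg H y) (sym T0≡v) (sym Tm≡u)
                                          (subst (suc m ≤_) (+-comm (deg H u) _) enough))
    where
    T : Arrangement (suc m)
    T = reindex S rotation
    T0≡v : at T 0 ≡ v
    T0≡v = trans (cong (at S) (next-suc (≤-trans (s≤s (s≤s z≤n)) 3≤n))) S1≡v
    Tm≡u : at T m ≡ u
    Tm≡u = trans (cong (at S) (next-last {k = m} refl)) S0≡u
...   | no Sm≢v  | no S1≢v  = S , HamCycle-avoiding H u≢v 3≤n S cycle S0≡u S1≢v Sm≢v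

identityArrangement : ∀ {n} .{{_ : NonZero n}} → Arrangement n
identityArrangement {n} = record
  { at          = _mod n
  ; position    = toℕ
  ; position<   = toℕ<n
  ; at-position = λ a → toℕ-injective (toℕ-mod (toℕ<n a))
  ; position-at = toℕ-mod
  }
  where
  toℕ-mod : ∀ {k} → k < n → toℕ (k mod n) ≡ k
  toℕ-mod k<n = trans (toℕ-fromℕ< _) (m<n⇒m%n≡m k<n)

next≢ : ∀ {n k} → 2 ≤ n → k < n → next n k ≢ k
next≢ {n} {k} 2≤n k<n with m≤n⇒m<n∨m≡n k<n
... | inj₁ k+1<n = 1+n≢n ∘ trans (sym (next-suc k+1<n))
... | inj₂ refl  = λ next≡k → ≤⇒≯ 2≤n (s≤s (subst (_< 1) (trans (sym (next-last {k = k} refl)) next≡k) z<s))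

complete⇒Hamiltonian : ∀ {n} (H : Graph n) → 3 ≤ n → (∀ a b → a ≢ b → adj H a b ≡ true) → Hamiltonian H
complete⇒Hamiltonian {suc m} H 3≤n complete = identityArrangement , λ k<n →
  complete _ _ (next≢ (≤-trans (n≤1+n 2) 3≤n) k<n ∘ sym ∘ at-injective identityArrangement k<n (next< k<n))

any-nonEdge? : ∀ {n} (H : Graph n) → Dec (∃ λ a → ∃ λ b → NonEdge H a b)
any-nonEdge? H = any? λ a → any? λ b → nonEdge? H a b

degreeSum<n*n : ∀ {n} (H : Graph n) → 0 < n → degreeSum H < n * n
degreeSum<n*n {n} H 0<n =
  subst (degreeSum H <_) (sumFin-const n n) (sumFin-mono-< (λ b → <⇒≤ (deg<n H b)) a (deg<n H a))
  where
  a : Fin n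
  a = fromℕ< 0<n

module _ {n} (3≤n : 3 ≤ n) (P : Graph n → Set)
  (P-addEdge : ∀ {H u v} (u≢v : u ≢ v) → P H → P (addEdge H u≢v))
  (P⇒OrePair : ∀ {H} → P H → ∀ {a b} → NonEdge H a b → ∃ λ u → ∃ λ v → OrePair H u v)
  where

  -- The fuel is at least n * n ∸ degreeSum H, which is positive and decreases with each added edge.
  private
    closure : ∀ fuel H → n * n ≤ degreeSum H + fuel → P H → Hamiltonian H
    closure zero H fuel-enough PH =
      ⊥-elim (<⇒≱ (degreeSum<n*n H (≤-trans (s≤s z≤n) 3≤n)) (subst (n * n ≤_) (+-identityʳ _) fuel-enough))
    closure (suc fuel) H fuel-enough PH with any-nonEdge? H
    ... | no noNonEdge = complete⇒Hamiltonian H 3≤n λ a b a≢b → ¬-not (λ ab → noNonEdge (a , b , a≢b , ab))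
    ... | yes (_ , _ , ab) with P⇒OrePair PH ab
    ...   | u , v , (u≢v , uv) , enough =
      bondy-chvátal H u≢v 3≤n enough (closure fuel H′ fuel-enough′ (P-addEdge u≢v PH))
      where
      H′ : Graph n
      H′ = addEdge H u≢v
      fuel-enough′ : n * n ≤ degreeSum H′ + fuel
      fuel-enough′ = ≤-trans fuel-enough (≤-trans (≤-reflexive (+-suc (degreeSum H) fuel))
                                                  (+-monoˡ-≤ fuel (degreeSum-addEdge H u≢v uv)))

  closure⇒Hamiltonian : ∀ H → P H → Hamiltonian H
  closure⇒Hamiltonian H = closure (n * n) H (m≤n+m (n * n) (degreeSum H))

-- Chvátal's degree counting

module _ {n} (H : Graph n) where

  private
    -- Edges weigh 0, so an argmax taken from a non-edge is a non-edge of maximal degree sum.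
    nonEdgeWeight : Fin n × Fin n → ℕ
    nonEdgeWeight (x , y) with nonEdge? H x y
    ... | yes _ = suc (deg H x + deg H y)
    ... | no  _ = 0

    nonEdgeWeight-nonEdge : ∀ {x y} → NonEdge H x y → nonEdgeWeight (x , y) ≡ suc (deg H x + deg H y)
    nonEdgeWeight-nonEdge {x} {y} xy with nonEdge? H x y
    ... | yes _  = refl
    ... | no ¬xy = ⊥-elim (¬xy xy)

    nonEdgeWeight>0 : ∀ {x y} → 0 < nonEdgeWeight (x , y) → NonEdge H x y
    nonEdgeWeight>0 {x} {y} w>0 with nonEdge? H x y
    ... | yes xy = xy

  maximalNonEdge : ∀ {a b} → NonEdge H a b → ∃ λ u → ∃ λ v →
    NonEdge H u v × (∀ {x y} → NonEdge H x y → deg H x + deg H y ≤ deg H u + deg H v)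
  maximalNonEdge {a} {b} ab = u , v , nonEdgeWeight>0 best>0 , maximal
    where
    pairs : List (Fin n × Fin n)
    pairs = cartesianProduct (allFin n) (allFin n)
    best : Fin n × Fin n
    best = argmax nonEdgeWeight (a , b) pairs
    u v : Fin n
    u = proj₁ best
    v = proj₂ best

    best>0 : 0 < nonEdgeWeight (u , v)
    best>0 = <-≤-trans (subst (0 <_) (sym (nonEdgeWeight-nonEdge ab)) z<s)
                       (f[⊥]≤f[argmax] {f = nonEdgeWeight} (a , b) pairs)
    maximal : ∀ {x y} → NonEdge H x y → deg H x + deg H y ≤ deg H u + deg H v
    maximal {x} {y} xy = s≤s⁻¹ (subst₂ _≤_ (nonEdgeWeight-nonEdge xy) (nonEdgeWeight-nonEdge (nonEdgeWeight>0 best>0))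
      (lookup (f[xs]≤f[argmax] {f = nonEdgeWeight} (a , b) pairs)
              (∈-cartesianProduct⁺ (∈-allFin x) (∈-allFin y))))

-- By maximality, the non-neighbours of u have degree ≤ n - 1 - i and those of v other than v
-- degree ≤ i.
module _ {n} (H : Graph n) {u v : Fin n} (u≤v : deg H u ≤ deg H v) (small : deg H u + deg H v < n)
         (maximal : ∀ {x y} → NonEdge H x y → deg H x + deg H y ≤ deg H u + deg H v) where

  private
    i j N : ℕ
    i = deg H u
    j = deg H v
    N = n ∸ 1

    i+j≤N : i + j ≤ N
    i+j≤N = ∸-monoˡ-≤ 1 small

    j≤N∸i : j ≤ N ∸ i
    j≤N∸i = subst (_≤ N ∸ i) (m+n∸m≡n i j) (∸-monoˡ-≤ i i+j≤N)

    i≤N∸i : i ≤ N ∸ i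
    i≤N∸i = ≤-trans u≤v j≤N∸i

    low mid : Fin n → Bool
    low w = deg H w ≤ᵇ i
    mid w = deg H w ≤ᵇ N ∸ i

    nonNeighbours : ∀ x → countTrue (not ∘ adj H x) ≡ n ∸ deg H x
    nonNeighbours x = sym (trans (cong (_∸ deg H x) (sym (countTrue-not (adj H x)))) (m+n∸m≡n (deg H x) _))

    i≤#low : i ≤ countTrue low
    i≤#low = s≤s⁻¹ (begin
      suc i                                            ≤⟨ m+n≤o⇒m≤o∸n (suc i) small ⟩
      n ∸ j                                            ≡⟨ nonNeighbours v ⟨
      countTrue (not ∘ adj H v)                        ≡⟨ countTrue-remove v (not ∘ adj H v) ⟨
      countTrue others + iverson (not (adj H v v))
                                                       ≡⟨ cong (λ b → countTrue others + iverson (not b)) (adj-irr H v) ⟩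
      countTrue others + 1                             ≡⟨ +-comm _ 1 ⟩
      suc (countTrue others)                           ≤⟨ s≤s (countTrue-mono others⊆low) ⟩
      suc (countTrue low)                              ∎)
      where
      open ≤-Reasoning
      others : Fin n → Bool
      others w = not (v == w) ∧ not (adj H v w)
      others⊆low : ∀ w → others w ≡ true → low w ≡ true
      others⊆low w p with v ≟ w
      ... | no v≢w = ≤ᵇ-true (+-cancelʳ-≤ j _ _ (maximal (v≢w ∘ sym , trans (adj-sym H w v) (not-injective p))))

    n∸i≤#mid : n ∸ i ≤ countTrue mid
    n∸i≤#mid = subst (_≤ countTrue mid) (nonNeighbours u) (countTrue-mono mid-of-nonNeighbour)
      where
      mid-of-nonNeighbour : ∀ w → not (adj H u w) ≡ true → mid w ≡ true
      mid-of-nonNeighbour w uw with w ≟ u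
      ... | yes refl = ≤ᵇ-true i≤N∸i
      ... | no  w≢u  = ≤ᵇ-true (≤-trans (+-cancelʳ-≤ i _ _ w+u≤v+u) j≤N∸i)
        where
        w+u≤v+u : deg H w + i ≤ j + i
        w+u≤v+u = subst (deg H w + i ≤_) (+-comm i j) (maximal (w≢u , trans (adj-sym H w u) (not-injective uw)))

    i+i≤N : i + i ≤ N
    i+i≤N = ≤-trans (+-monoʳ-≤ i u≤v) i+j≤N

    budget : Fin n → ℕ
    budget w = deg H w + (if mid w then i else 0) + (if low w then N ∸ (i + i) else 0)

    budget≤N : ∀ w → budget w ≤ N
    budget≤N w with deg H w ≤? i | deg H w ≤? N ∸ i
    ... | yes w≤i | no w≰N∸i  = ⊥-elim (w≰N∸i (≤-trans w≤i i≤N∸i))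
    ... | yes w≤i | yes w≤N∸i rewrite ≤ᵇ-true w≤i | ≤ᵇ-true w≤N∸i = begin
      deg H w + i + (N ∸ (i + i)) ≤⟨ +-monoˡ-≤ _ (+-monoˡ-≤ i w≤i) ⟩
      i + i + (N ∸ (i + i))       ≡⟨ m+[n∸m]≡n i+i≤N ⟩
      N                           ∎
      where open ≤-Reasoning
    ... | no w≰i  | yes w≤N∸i rewrite ≤ᵇ-false (≰⇒> w≰i) | ≤ᵇ-true w≤N∸i = begin
      deg H w + i + 0             ≡⟨ +-identityʳ _ ⟩
      deg H w + i                 ≤⟨ +-monoˡ-≤ i w≤N∸i ⟩
      N ∸ i + i                   ≡⟨ m∸n+n≡m (≤-trans (m≤m+n i i) i+i≤N) ⟩
      N                           ∎
      where open ≤-Reasoning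
    ... | no w≰i  | no w≰N∸i  rewrite ≤ᵇ-false (≰⇒> w≰i) | ≤ᵇ-false (≰⇒> w≰N∸i) = begin
      deg H w + 0 + 0             ≡⟨ trans (+-identityʳ _) (+-identityʳ _) ⟩
      deg H w                     ≤⟨ ∸-monoˡ-≤ 1 (deg<n H w) ⟩
      N                           ∎
      where open ≤-Reasoning

  degreeSum-bound : degreeSum H + i * (n ∸ i) + (N ∸ (i + i)) * i ≤ n * N
  degreeSum-bound = begin
    degreeSum H + i * (n ∸ i) + c * i
      ≤⟨ +-mono-≤ (+-monoʳ-≤ (degreeSum H) (*-monoʳ-≤ i n∸i≤#mid)) (*-monoʳ-≤ c i≤#low) ⟩
    degreeSum H + i * countTrue mid + c * countTrue low
      ≡⟨ cong₂ (λ x y → degreeSum H + x + y) (sumFin-if i mid) (sumFin-if c low) ⟨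
    degreeSum H + sumFin (λ w → if mid w then i else 0) + sumFin (λ w → if low w then c else 0)
      ≡⟨ cong (_+ sumFin (λ w → if low w then c else 0)) (sumFin-+ (deg H) _) ⟨
    sumFin (λ w → deg H w + (if mid w then i else 0)) + sumFin (λ w → if low w then c else 0)
      ≡⟨ sumFin-+ (λ w → deg H w + (if mid w then i else 0)) _ ⟨
    sumFin budget
      ≤⟨ sumFin-mono budget≤N ⟩
    sumFin {n} (λ _ → N)
      ≡⟨ sumFin-const n N ⟩
    n * N ∎
    where
    open ≤-Reasoning
    c : ℕ
    c = N ∸ (i + i)

-- The extremal graph

-- Every vertex of K_δ ∨ (K_{n-2δ+1} ∪ (δ-1)K_1) has degree ≥ δ; the n - δ + 1 vertices outside
-- (δ-1)K_1 have n - 2δ more, and the δ vertices of K_δ another δ - 1.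
extremalDegreeSum : ℕ → ℕ → ℕ
extremalDegreeSum n δ = n * δ + (n ∸ (δ + δ)) * (n ∸ δ + 1) + (δ ∸ 1) * δ

module _ {n δ : ℕ} (1≤δ : 1 ≤ δ) (δ+δ≤n : δ + δ ≤ n) where

  private
    M W D : ℕ
    M = n ∸ δ + 1
    W = n ∸ (δ + δ)
    D = δ ∸ 1

    δ+δ+W≡n : δ + δ + W ≡ n
    δ+δ+W≡n = m+[n∸m]≡n δ+δ≤n

    1+D≡δ : 1 + D ≡ δ
    1+D≡δ = m+[n∸m]≡n 1≤δ

    δ+W+1≡M : δ + W + 1 ≡ M
    δ+W+1≡M = cong (_+ 1) (sym (begin
      n ∸ δ             ≡⟨ cong (_∸ δ) δ+δ+W≡n ⟨
      δ + δ + W ∸ δ     ≡⟨ cong (_∸ δ) (+-assoc δ δ W) ⟩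
      δ + (δ + W) ∸ δ   ≡⟨ m+n∸m≡n δ (δ + W) ⟩
      δ + W             ∎))
      where open ≡-Reasoning

    δ≤M : δ ≤ M
    δ≤M = subst (δ ≤_) δ+W+1≡M (≤-trans (m≤m+n δ W) (m≤m+n (δ + W) 1))

    M≤n : M ≤ n
    M≤n = subst₂ _≤_ (trans (+-comm 1 (δ + W)) δ+W+1≡M) (trans (sym (+-assoc δ δ W)) δ+δ+W≡n)
                     (+-monoˡ-≤ (δ + W) 1≤δ)

    δ≤n : δ ≤ n
    δ≤n = ≤-trans (m≤m+n δ δ) δ+δ≤n

    class : Fin n → Cls
    class j = cls n δ (toℕ j)

    rel-B : ∀ j → rel B (class j) ≡ (toℕ j <ᵇ M)
    rel-B j with toℕ j <? δ | toℕ j <? M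
    ... | yes j<δ | yes j<M rewrite <ᵇ-true j<δ | <ᵇ-true j<M = refl
    ... | yes j<δ | no  j≮M = ⊥-elim (j≮M (<-≤-trans j<δ δ≤M))
    ... | no  j≮δ | yes j<M rewrite <ᵇ-false (≮⇒≥ j≮δ) | <ᵇ-true j<M = refl
    ... | no  j≮δ | no  j≮M rewrite <ᵇ-false (≮⇒≥ j≮δ) | <ᵇ-false (≮⇒≥ j≮M) = refl

    rel-C : ∀ j → rel C (class j) ≡ (toℕ j <ᵇ δ)
    rel-C j with toℕ j <? δ
    ... | yes j<δ rewrite <ᵇ-true j<δ = refl
    ... | no  j≮δ rewrite <ᵇ-false (≮⇒≥ j≮δ) with toℕ j <ᵇ M
    ...   | true  = refl
    ...   | false = refl

    deg+loop-at : ∀ v c → class v ≡ c → deg (Extremal n δ) v + iverson (rel c c) ≡ countTrue (rel c ∘ class)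
    deg+loop-at v _ refl = countTrue-remove v (rel (class v) ∘ class)

    class-A : ∀ {t} → t < δ → cls n δ t ≡ A
    class-A t<δ rewrite <ᵇ-true t<δ = refl

    class-B : ∀ {t} → δ ≤ t → t < M → cls n δ t ≡ B
    class-B δ≤t t<M rewrite <ᵇ-false δ≤t | <ᵇ-true t<M = refl

    class-C : ∀ {t} → δ ≤ t → M ≤ t → cls n δ t ≡ C
    class-C δ≤t M≤t rewrite <ᵇ-false δ≤t | <ᵇ-false M≤t = refl

    degree : ℕ → ℕ
    degree t = δ + (if t <ᵇ M then W else 0) + (if t <ᵇ δ then D else 0)

    degree-A : ∀ {t} → t < δ → degree t + 1 ≡ n
    degree-A t<δ rewrite <ᵇ-true t<δ | <ᵇ-true (<-≤-trans t<δ δ≤M) = begin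
      δ + W + D + 1   ≡⟨ solve 3 (λ δ W D → δ :+ W :+ D :+ con 1 := δ :+ (con 1 :+ D) :+ W) refl δ W D ⟩
      δ + (1 + D) + W ≡⟨ cong (λ x → δ + x + W) 1+D≡δ ⟩
      δ + δ + W       ≡⟨ δ+δ+W≡n ⟩
      n               ∎
      where open ≡-Reasoning

    degree-B : ∀ {t} → δ ≤ t → t < M → degree t + 1 ≡ M
    degree-B δ≤t t<M rewrite <ᵇ-false δ≤t | <ᵇ-true t<M = trans (cong (_+ 1) (+-identityʳ (δ + W))) δ+W+1≡M

    degree-C : ∀ {t} → δ ≤ t → M ≤ t → degree t ≡ δ
    degree-C δ≤t M≤t rewrite <ᵇ-false δ≤t | <ᵇ-false M≤t = trans (+-identityʳ (δ + 0)) (+-identityʳ δ)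

  deg-Extremal : ∀ v → deg (Extremal n δ) v ≡ degree (toℕ v)
  deg-Extremal v with toℕ v <? δ | toℕ v <? M
  ... | yes v<δ | _       = +-cancelʳ-≡ 1 _ _ (begin
    deg (Extremal n δ) v + 1      ≡⟨ deg+loop-at v A (class-A v<δ) ⟩
    countTrue {n} (λ _ → true)    ≡⟨ countTrue-true {n} (λ _ → refl) ⟩
    n                             ≡⟨ degree-A v<δ ⟨
    degree (toℕ v) + 1            ∎)
    where open ≡-Reasoning
  ... | no v≮δ  | yes v<M = +-cancelʳ-≡ 1 _ _ (begin
    deg (Extremal n δ) v + 1      ≡⟨ deg+loop-at v B (class-B (≮⇒≥ v≮δ) v<M) ⟩
    countTrue (rel B ∘ class)     ≡⟨ countTrue-cong rel-B ⟩
    countTrue {n} (λ j → toℕ j <ᵇ M) ≡⟨ countTrue-<ᵇ M M≤n ⟩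
    M                             ≡⟨ degree-B (≮⇒≥ v≮δ) v<M ⟨
    degree (toℕ v) + 1            ∎)
    where open ≡-Reasoning
  ... | no v≮δ  | no v≮M  = +-cancelʳ-≡ 0 _ _ (begin
    deg (Extremal n δ) v + 0      ≡⟨ deg+loop-at v C (class-C (≮⇒≥ v≮δ) (≮⇒≥ v≮M)) ⟩
    countTrue (rel C ∘ class)     ≡⟨ countTrue-cong rel-C ⟩
    countTrue {n} (λ j → toℕ j <ᵇ δ) ≡⟨ countTrue-<ᵇ δ δ≤n ⟩
    δ                             ≡⟨ degree-C (≮⇒≥ v≮δ) (≮⇒≥ v≮M) ⟨
    degree (toℕ v)                ≡⟨ +-identityʳ _ ⟨
    degree (toℕ v) + 0            ∎)
    where open ≡-Reasoning

  degreeSum-Extremal : degreeSum (Extremal n δ) ≡ extremalDegreeSum n δ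
  degreeSum-Extremal = begin
    sumFin (deg (Extremal n δ))
      ≡⟨ sumFin-cong deg-Extremal ⟩
    sumFin (λ v → δ + (if below M v then W else 0) + (if below δ v then D else 0))
      ≡⟨ sumFin-+ (λ v → δ + (if below M v then W else 0)) _ ⟩
    sumFin (λ v → δ + (if below M v then W else 0)) + sumFin (λ v → if below δ v then D else 0)
      ≡⟨ cong (_+ sumFin (λ v → if below δ v then D else 0)) (sumFin-+ {n} (λ _ → δ) _) ⟩
    sumFin {n} (λ _ → δ) + sumFin (λ v → if below M v then W else 0) + sumFin (λ v → if below δ v then D else 0)
      ≡⟨ cong₂ _+_ (cong₂ _+_ (sumFin-const n δ) (sumFin-if W (below M))) (sumFin-if D (below δ)) ⟩
    n * δ + W * countTrue (below M) + D * countTrue (below δ)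
      ≡⟨ cong₂ (λ x y → n * δ + W * x + D * y) (countTrue-<ᵇ M M≤n) (countTrue-<ᵇ δ δ≤n) ⟩
    n * δ + W * M + D * δ ∎
    where
    open ≡-Reasoning
    below : ℕ → Fin n → Bool
    below k v = toℕ v <ᵇ k

∸-from-+ : ∀ {a b c} → a + b ≡ c → c ∸ a ≡ b
∸-from-+ {a} refl = m+n∸m≡n a _

-- Writing δ = 2 + d, i = δ + t and n = 2(i + r + 1), the right side of extremalDegreeSum-gap
-- exceeds n(n-1) by K - 2δt, and n ≥ 6δ - 4 gives 2δ ≤ t + r + 3.
private
  module _ (d t r : ℕ) where

    δ i m n K : ℕ
    δ = 2 + d
    i = δ + t
    m = suc (i + r)
    n = m + m
    K = t * t + 7 * t + 4 + 4 * (r * t) + 4 * r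

    n∸δ+δ : n ∸ (δ + δ) ≡ t + t + 2 + r + r
    n∸δ+δ = ∸-from-+ {δ + δ} (solve 3 (λ d t r → let δ = con 2 :+ d ; m = con 1 :+ (δ :+ t :+ r) in
      (δ :+ δ) :+ (t :+ t :+ con 2 :+ r :+ r) := m :+ m) refl d t r)

    n∸δ : n ∸ δ ≡ δ + t + t + 2 + r + r
    n∸δ = ∸-from-+ {δ} (solve 3 (λ d t r → let δ = con 2 :+ d ; m = con 1 :+ (δ :+ t :+ r) in
      δ :+ (δ :+ t :+ t :+ con 2 :+ r :+ r) := m :+ m) refl d t r)

    n∸i : n ∸ i ≡ δ + t + 2 + r + r
    n∸i = ∸-from-+ {i} (solve 3 (λ d t r → let δ = con 2 :+ d ; m = con 1 :+ (δ :+ t :+ r) in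
      (δ :+ t) :+ (δ :+ t :+ con 2 :+ r :+ r) := m :+ m) refl d t r)

    n∸1∸[i+i] : n ∸ 1 ∸ (i + i) ≡ suc (r + r)
    n∸1∸[i+i] = ∸-from-+ {i + i} (solve 3 (λ d t r → let i = con 2 :+ d :+ t in
      (i :+ i) :+ (con 1 :+ (r :+ r)) := (i :+ r) :+ (con 1 :+ (i :+ r))) refl d t r)

    gap-identity : extremalDegreeSum n δ + i * (n ∸ i) + (n ∸ 1 ∸ (i + i)) * i + 2 * δ * t ≡ n * (n ∸ 1) + K
    gap-identity rewrite n∸δ+δ | n∸δ | n∸i | n∸1∸[i+i] = solve 3 (λ d t r →
      let δ = con 2 :+ d ; i = δ :+ t ; m = con 1 :+ (i :+ r) ; n = m :+ m in
      n :* δ :+ (t :+ t :+ con 2 :+ r :+ r) :* (δ :+ t :+ t :+ con 2 :+ r :+ r :+ con 1) :+ (con 1 :+ d) :* δ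
        :+ i :* (δ :+ t :+ con 2 :+ r :+ r) :+ (con 1 :+ (r :+ r)) :* i :+ con 2 :* δ :* t
      := n :* (i :+ r :+ (con 1 :+ (i :+ r))) :+ (t :* t :+ con 7 :* t :+ con 4 :+ con 4 :* (r :* t) :+ con 4 :* r))
      refl d t r

    2δ≤t+r+3 : 6 * δ ≤ n + 4 → 2 * δ ≤ t + r + 3
    2δ≤t+r+3 6δ≤n+4 = *-cancelˡ-≤ 2 (+-cancelʳ-≤ (2 * δ) (2 * (2 * δ)) (2 * (t + r + 3)) (subst₂ _≤_
      (solve 1 (λ δ → con 6 :* δ := con 2 :* (con 2 :* δ) :+ con 2 :* δ) refl δ)
      (solve 3 (λ d t r → let δ = con 2 :+ d ; m = con 1 :+ (δ :+ t :+ r) in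
        m :+ m :+ con 4 := con 2 :* (t :+ r :+ con 3) :+ con 2 :* δ) refl d t r)
      6δ≤n+4))

    2δt<K : 6 * δ ≤ n + 4 → 2 * δ * t < K
    2δt<K 6δ≤n+4 = begin-strict
      2 * δ * t                                      ≤⟨ *-monoˡ-≤ t (2δ≤t+r+3 6δ≤n+4) ⟩
      (t + r + 3) * t
        ≡⟨ solve 2 (λ t r → (t :+ r :+ con 3) :* t := t :* t :+ r :* t :+ con 3 :* t) refl t r ⟩
      t * t + r * t + 3 * t                          <⟨ m<m+n _ z<s ⟩
      t * t + r * t + 3 * t + (4 + 4 * t + 3 * (r * t) + 4 * r)
        ≡⟨ solve 2 (λ t r → t :* t :+ r :* t :+ con 3 :* t :+ (con 4 :+ con 4 :* t :+ con 3 :* (r :* t) :+ con 4 :* r)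
                        := t :* t :+ con 7 :* t :+ con 4 :+ con 4 :* (r :* t) :+ con 4 :* r) refl t r ⟩
      K                                              ∎
      where open ≤-Reasoning

    extremalDegreeSum-gap′ : 6 * δ ≤ n + 4 → n * (n ∸ 1) < extremalDegreeSum n δ + i * (n ∸ i) + (n ∸ 1 ∸ (i + i)) * i
    extremalDegreeSum-gap′ 6δ≤n+4 = +-cancelʳ-< (2 * δ * t) _ _ (begin-strict
      n * (n ∸ 1) + 2 * δ * t  <⟨ +-monoʳ-< (n * (n ∸ 1)) (2δt<K 6δ≤n+4) ⟩
      n * (n ∸ 1) + K          ≡⟨ gap-identity ⟨
      extremalDegreeSum n δ + i * (n ∸ i) + (n ∸ 1 ∸ (i + i)) * i + 2 * δ * t ∎)
      where open ≤-Reasoning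

extremalDegreeSum-gap : ∀ {δ i n} → 2 ≤ δ → δ ≤ i → i + i < n → 2 ∣ n → 6 * δ ∸ 4 ≤ n →
  n * (n ∸ 1) < extremalDegreeSum n δ + i * (n ∸ i) + (n ∸ 1 ∸ (i + i)) * i
extremalDegreeSum-gap {δ} {i} 2≤δ δ≤i i+i<n (divides k refl) 6δ∸4≤n
  with m≤n⇒∃[o]m+o≡n 2≤δ | m≤n⇒∃[o]m+o≡n δ≤i
     | m≤n⇒∃[o]m+o≡n (*-cancelʳ-< 2 i k (subst (_< k * 2) (solve 1 (λ i → i :+ i := i :* con 2) refl i) i+i<n))
... | d , refl | t , refl | r , refl =
  subst (λ n → 6 * δ ≤ n + 4 → n * (n ∸ 1) < extremalDegreeSum n δ + i * (n ∸ i) + (n ∸ 1 ∸ (i + i)) * i)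
        (solve 1 (λ m → m :+ m := m :* con 2) refl (suc (i + r)))
        (extremalDegreeSum-gap′ d t r)
        (subst (6 * δ ≤_) (+-comm 4 _) (≤-trans (m≤n+m∸n (6 * δ) 4) (+-monoʳ-≤ 4 6δ∸4≤n)))

δ+δ≤6δ∸4 : ∀ {δ} → 1 ≤ δ → δ + δ ≤ 6 * δ ∸ 4
δ+δ≤6δ∸4 {δ} 1≤δ = m+n≤o⇒m≤o∸n (δ + δ) (subst (δ + δ + 4 ≤_)
  (solve 1 (λ δ → δ :+ δ :+ con 4 :* δ := con 6 :* δ) refl δ) (+-monoʳ-≤ (δ + δ) (*-monoʳ-≤ 4 1≤δ)))

record Dense {n} (δ : ℕ) (H : Graph n) : Set where
  field
    minDegree          : ∀ v → δ ≤ deg H v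
    extremal≤degreeSum : extremalDegreeSum n δ ≤ degreeSum H

Dense-addEdge : ∀ {n δ} {H : Graph n} {u v} (u≢v : u ≢ v) → Dense δ H → Dense δ (addEdge H u≢v)
Dense-addEdge {H = H} u≢v dense = record
  { minDegree          = λ w → ≤-trans (minDegree w) (deg-addEdge H u≢v w)
  ; extremal≤degreeSum = ≤-trans extremal≤degreeSum (sumFin-mono (deg-addEdge H u≢v))
  }
  where open Dense dense

module _ {n δ} (2≤δ : 2 ≤ δ) (2∣n : 2 ∣ n) (6δ∸4≤n : 6 * δ ∸ 4 ≤ n) {H : Graph n} (dense : Dense δ H) where

  open Dense dense

  private
    maximal⇒OrePair : ∀ {u v} → NonEdge H u v → deg H u ≤ deg H v →
      (∀ {x y} → NonEdge H x y → deg H x + deg H y ≤ deg H u + deg H v) → OrePair H u v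
    maximal⇒OrePair {u} {v} uv u≤v maximal = uv , ≮⇒≥ λ small →
      <⇒≱ (extremalDegreeSum-gap 2≤δ (minDegree u) (≤-<-trans (+-monoʳ-≤ (deg H u) u≤v) small) 2∣n 6δ∸4≤n)
          (≤-trans (+-monoˡ-≤ _ (+-monoˡ-≤ _ extremal≤degreeSum)) (degreeSum-bound H u≤v small maximal))

  Dense⇒OrePair : ∀ {a b} → NonEdge H a b → ∃ λ u → ∃ λ v → OrePair H u v
  Dense⇒OrePair ab with maximalNonEdge H ab
  ... | u , v , uv , maximal with deg H u ≤? deg H v
  ...   | yes u≤v = u , v , maximal⇒OrePair uv u≤v maximal
  ...   | no  u≰v = v , u , maximal⇒OrePair (NonEdge-sym {H = H} uv) (≰⇒≥ u≰v) maximal′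
    where
    maximal′ : ∀ {x y} → NonEdge H x y → deg H x + deg H y ≤ deg H v + deg H u
    maximal′ {x} {y} xy = subst (deg H x + deg H y ≤_) (+-comm (deg H u) _) (maximal xy)

theorem1p1 : (δ n : ℕ) → 2 ≤ δ → 2 ∣ n → (6 * δ) ∸ 4 ≤ n → δ * δ + 7 * δ + 4 ≤ 6 * n →
    (G : Graph n) → Connected G → MinDegree G δ →
    e (Extremal n δ) ≤ e G →
    ¬ (G ≅ Extremal n δ) → HasEvenFactor G
theorem1p1 δ n 2≤δ 2∣n 6δ∸4≤n _ G _ (minDegree , _) e-Extremal≤e-G _ =
  hamiltonian⇒evenFactor {H = G} 3≤n
    (closure⇒Hamiltonian 3≤n (Dense δ) Dense-addEdge (Dense⇒OrePair 2≤δ 2∣n 6δ∸4≤n) G dense)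
  where
  1≤δ : 1 ≤ δ
  1≤δ = ≤-trans (s≤s z≤n) 2≤δ
  δ+δ≤n : δ + δ ≤ n
  δ+δ≤n = ≤-trans (δ+δ≤6δ∸4 1≤δ) 6δ∸4≤n
  3≤n : 3 ≤ n
  3≤n = ≤-trans (+-mono-≤ 2≤δ 1≤δ) δ+δ≤n
  dense : Dense δ G
  dense = record { minDegree = minDegree ; extremal≤degreeSum = extremal≤degreeSum }
    where
    open ≤-Reasoning
    extremal≤degreeSum : extremalDegreeSum n δ ≤ degreeSum G
    extremal≤degreeSum = begin
      extremalDegreeSum n δ                   ≡⟨ degreeSum-Extremal 1≤δ δ+δ≤n ⟨
      degreeSum (Extremal n δ)                ≡⟨ degreeSum≡e+e (Extremal n δ) ⟩
      e (Extremal n δ) + e (Extremal n δ)     ≤⟨ +-mono-≤ e-Extremal≤e-G e-Extremal≤e-G ⟩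
      e G + e G                               ≡⟨ degreeSum≡e+e G ⟨
      degreeSum G                             ∎
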